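{- Let $k\ge2$, let $B=(1,b_2,\dots,b_k)$ be positive integers with $1<b_2<\cdots<b_k$, let $c=\max\{O_B(r)\mid 0\le r\le b_k-1\}$ and $u=\max\left\{c-1,\left\lceil\frac{(c-1)b_{k-1}}{b_k-b_{k-1}}\right\rceil\right\}$. Let $a,h,d$ be positive integers with $\gcd(a,d)=1$, and for $0\le r\le a-1$ let $N_{dr}:=\min\{O_B(ma+r)\cdot ha+(ma+r)d\mid m\in\mathbb{N}\}$. If $a\ge (u+c-1)b_k$, then $$\max_{0\le r\le a-1} N_{dr}=\max_{a-b_k\le r\le a-1}N_{dr}.$$
   Context: For $M\in\mathbb{N}$, $O_B(M):=\min\{\sum_{i=1}^k x_i \mid \sum_{i=1}^k b_ix_i=M,\ x_i\in\mathbb{N}\}$ with $b_1=1$. $\mathbb{N}$ denotes the nonnegative integers. -}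

module Defs where

open import Data.Nat using (ℕ; zero; suc; _+_; _*_; _∸_; _≤_; _<_)
open import Data.Nat.DivMod using (_/_)
open import Data.Fin using (Fin; fromℕ; inject₁)
import Data.Fin as F
open import Data.Product using (Σ; ∃; _×_)
open import Relation.Binary.PropositionalEquality using (_≡_)

IsLeast : (ℕ → Set) → ℕ → Set
IsLeast P v = P v × (∀ w → P w → v ≤ w)

IsGreatest : (ℕ → Set) → ℕ → Set
IsGreatest P v = P v × (∀ w → P w → w ≤ v)

sumF : ∀ {k} → (Fin k → ℕ) → ℕ
sumF {zero}  f = 0
sumF {suc k} f = f F.zero + sumF (λ i → f (F.suc i))

CoinCounts : ∀ {k} → (Fin k → ℕ) → ℕ → ℕ → Set
CoinCounts b M v = Σ (Fin _ → ℕ) λ x → (sumF (λ i → b i * x i) ≡ M) × (sumF x ≡ v)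

IsOB : ∀ {k} → (Fin k → ℕ) → ℕ → ℕ → Set
IsOB b M v = IsLeast (CoinCounts b M) v

-- ⌈ p / q ⌉ for q > 0 (value at q = 0 irrelevant)
ceilDiv : ℕ → ℕ → ℕ
ceilDiv p zero    = 0
ceilDiv p (suc q) = (p + q) / suc q

-- Every residue r < a can be shifted by a multiple of bₖ into the window [a − bₖ, a), and N_{dr} does not
-- decrease under this shift because O_B(M) ≤ O_B(M + j bₖ) whenever M + j bₖ ≥ a − bₖ. For M ≥ (u − 1) bₖ
-- one step suffices: an optimal representation of M + bₖ either contains a coin bₖ, whose removal
-- represents M with one coin less, or uses only coins ≤ bₖ₋₁, and then by the choice of u it has at least
-- ⌊M/bₖ⌋ + c coins, which dominates the greedy bound O_B(M) ≤ ⌊M/bₖ⌋ + O_B(M mod bₖ) ≤ ⌊M/bₖ⌋ + c.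
-- For smaller M the greedy bound is compared directly with O_B(N) ≥ N/bₖ, using a ≥ (u + c − 1) bₖ.

module Submission where

open import Defs
open import Data.Nat using (ℕ; zero; suc; _+_; _*_; _∸_; _≤_; _<_; _⊔_; z≤n; s≤s; s≤s⁻¹; _≤?_; NonZero; >-nonZero; >-nonZero⁻¹)
open import Data.Nat.Properties
open import Data.Nat.DivMod using (_/_; _%_; m≡m%n+[m/n]*n; m%n<n; m/n*n≤m; m*n/n≡m; /-monoˡ-≤; m<n*o⇒m/o<n)
open import Data.Nat.Induction using (<-rec)
open import Data.Nat.GCD using (gcd)
open import Algebra.Properties.CommutativeSemigroup +-commutativeSemigroup using (interchange; x∙yz≈y∙xz)
open import Data.Fin using (Fin; fromℕ; inject₁; toℕ)
import Data.Fin as F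
open import Data.Fin.Properties using (toℕ-injective; toℕ-fromℕ; toℕ-inject₁; toℕ≤pred[n]; ≤fromℕ; ≤̄⇒inject₁<)
open import Data.List using (filter; allFin; upTo)
open import Data.List.Extrema.Nat using (argmin; argmin-all; f[argmin]≤f[xs]; f[argmin]≤f[⊤])
open import Data.List.Membership.Propositional.Properties using (∈-filter⁺; ∈-allFin; ∈-upTo⁺)
open import Data.List.Relation.Unary.All using (lookup)
open import Data.List.Relation.Unary.All.Properties using (all-filter)
open import Data.Product using (Σ; ∃; _×_; _,_; proj₁; proj₂)
open import Data.Sum using (inj₁; inj₂)
open import Relation.Nullary using (yes; no)
open import Relation.Binary.PropositionalEquality

sumF-cong : ∀ {k} {f g : Fin k → ℕ} → (∀ i → f i ≡ g i) → sumF f ≡ sumF g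
sumF-cong {zero}  f≡g = refl
sumF-cong {suc k} f≡g = cong₂ _+_ (f≡g F.zero) (sumF-cong (λ i → f≡g (F.suc i)))

sumF-+ : ∀ {k} (f g : Fin k → ℕ) → sumF (λ i → f i + g i) ≡ sumF f + sumF g
sumF-+ {zero}  f g = refl
sumF-+ {suc k} f g =
  trans (cong (f F.zero + g F.zero +_) (sumF-+ (λ i → f (F.suc i)) (λ i → g (F.suc i))))
        (interchange (f F.zero) (g F.zero) _ _)

sumF-*ˡ : ∀ {k} (m : ℕ) (f : Fin k → ℕ) → sumF (λ i → m * f i) ≡ m * sumF f
sumF-*ˡ {zero}  m f = sym (*-zeroʳ m)
sumF-*ˡ {suc k} m f =
  trans (cong (m * f F.zero +_) (sumF-*ˡ m (λ i → f (F.suc i)))) (sym (*-distribˡ-+ m _ _))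

sumF-mono-≤ : ∀ {k} {f g : Fin k → ℕ} → (∀ i → f i ≤ g i) → sumF f ≤ sumF g
sumF-mono-≤ {zero}  f≤g = z≤n
sumF-mono-≤ {suc k} f≤g = +-mono-≤ (f≤g F.zero) (sumF-mono-≤ (λ i → f≤g (F.suc i)))

sumF-positive : ∀ {k} (f : Fin k → ℕ) → 0 < sumF f → ∃ λ i → 0 < f i
sumF-positive {suc k} f pos with f F.zero in eq
... | suc _ = F.zero , subst (0 <_) (sym eq) (s≤s z≤n)
... | zero  with sumF-positive (λ i → f (F.suc i)) pos
...   | i , fi>0 = F.suc i , fi>0

δ : ∀ {k} → Fin k → Fin k → ℕ
δ F.zero    F.zero    = 1
δ F.zero    (F.suc j) = 0
δ (F.suc i) F.zero    = 0
δ (F.suc i) (F.suc j) = δ i j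

sumF-zero : ∀ k → sumF {k} (λ _ → 0) ≡ 0
sumF-zero zero    = refl
sumF-zero (suc k) = sumF-zero k

sumF-*δ : ∀ {k} (f : Fin k → ℕ) (i : Fin k) → sumF (λ j → f j * δ i j) ≡ f i
sumF-*δ {suc k} f F.zero = begin
  f F.zero * 1 + sumF (λ j → f (F.suc j) * 0)  ≡⟨ cong₂ _+_ (*-identityʳ (f F.zero)) (sumF-cong (λ j → *-zeroʳ (f (F.suc j)))) ⟩
  f F.zero + sumF {k} (λ _ → 0)                ≡⟨ cong (f F.zero +_) (sumF-zero k) ⟩
  f F.zero + 0                                 ≡⟨ +-identityʳ (f F.zero) ⟩
  f F.zero                                     ∎
  where open ≡-Reasoning
sumF-*δ {suc k} f (F.suc i) = cong₂ _+_ (*-zeroʳ (f F.zero)) (sumF-*δ (λ j → f (F.suc j)) i)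

sumF-δ : ∀ {k} (i : Fin k) → sumF (δ i) ≡ 1
sumF-δ i = trans (sumF-cong (λ j → sym (*-identityˡ (δ i j)))) (sumF-*δ (λ _ → 1) i)

δ≤ : ∀ {k} (x : Fin k → ℕ) (i : Fin k) → 0 < x i → ∀ j → δ i j ≤ x j
δ≤ x F.zero    xi>0 F.zero    = xi>0
δ≤ x F.zero    xi>0 (F.suc j) = z≤n
δ≤ x (F.suc i) xi>0 F.zero    = z≤n
δ≤ x (F.suc i) xi>0 (F.suc j) = δ≤ (λ l → x (F.suc l)) i xi>0 j

module Coins {k} (b : Fin k → ℕ) where

  value : (Fin k → ℕ) → ℕ
  value x = sumF (λ i → b i * x i)

  value-+δ : ∀ (x : Fin k → ℕ) i → value (λ j → x j + δ i j) ≡ value x + b i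
  value-+δ x i = begin
    sumF (λ j → b j * (x j + δ i j))      ≡⟨ sumF-cong (λ j → *-distribˡ-+ (b j) (x j) (δ i j)) ⟩
    sumF (λ j → b j * x j + b j * δ i j)  ≡⟨ sumF-+ (λ j → b j * x j) (λ j → b j * δ i j) ⟩
    value x + sumF (λ j → b j * δ i j)    ≡⟨ cong (value x +_) (sumF-*δ b i) ⟩
    value x + b i                         ∎
    where open ≡-Reasoning

  count-+δ : ∀ (x : Fin k → ℕ) i → sumF (λ j → x j + δ i j) ≡ suc (sumF x)
  count-+δ x i = trans (sumF-+ x (δ i)) (trans (cong (sumF x +_) (sumF-δ i)) (+-comm (sumF x) 1))

  addCoin : ∀ {M v} → CoinCounts b M v → ∀ i → CoinCounts b (M + b i) (suc v)
  addCoin (x , refl , refl) i = (λ j → x j + δ i j) , value-+δ x i , count-+δ x i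

  removeCoin : ∀ {M v} (r : CoinCounts b M v) i → 0 < proj₁ r i →
    ∃ λ M′ → ∃ λ v′ → CoinCounts b M′ v′ × M ≡ M′ + b i × v ≡ suc v′
  removeCoin (x , refl , refl) i xi>0 =
    value y , sumF y , (y , refl , refl) ,
    trans (sumF-cong (λ j → cong (b j *_) (x≡y+δ j))) (value-+δ y i) ,
    trans (sumF-cong x≡y+δ) (count-+δ y i)
    where
    y : Fin k → ℕ
    y j = x j ∸ δ i j
    x≡y+δ : ∀ j → x j ≡ y j + δ i j
    x≡y+δ j = sym (m∸n+n≡m (δ≤ x i xi>0 j))

  value≤*count : ∀ {M v} β → ((x , _) : CoinCounts b M v) → (∀ j → b j * x j ≤ β * x j) → M ≤ β * v
  value≤*count β (x , refl , refl) bx≤βx = ≤-trans (sumF-mono-≤ bx≤βx) (≤-reflexive (sumF-*ˡ β x))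

module Optimal {k} (b : Fin (suc k) → ℕ) (b₀≡1 : b F.zero ≡ 1) (b>0 : ∀ i → 0 < b i) where
  open Coins b

  private
    empty : CoinCounts b 0 0
    empty = (λ _ → 0) , trans (sumF-cong (λ i → *-zeroʳ (b i))) (sumF-zero (suc k)) , sumF-zero (suc k)

    -- O(M) = 1 + min { O(M - bᵢ) | bᵢ ≤ M } for M > 0.
    optimal : ∀ M → (∀ {M′} → M′ < M → Σ ℕ (IsOB b M′)) → Σ ℕ (IsOB b M)
    optimal zero    _   = 0 , empty , λ _ _ → z≤n
    optimal (suc M) rec = suc (o best) , best-rep , best-least
      where
      residual< : ∀ i → suc M ∸ b i < suc M
      residual< i with b i | b>0 i
      ... | suc bᵢ | _ = s≤s (m∸n≤m M bᵢ)

      o : Fin (suc k) → ℕ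
      o i = proj₁ (rec (residual< i))

      o-spec : ∀ i → IsOB b (suc M ∸ b i) (o i)
      o-spec i = proj₂ (rec (residual< i))

      best : Fin (suc k)
      best = argmin o F.zero (filter (λ i → b i ≤? suc M) (allFin _))

      best-fits : b best ≤ suc M
      best-fits = argmin-all o (subst (_≤ suc M) (sym b₀≡1) (s≤s z≤n)) (all-filter (λ i → b i ≤? suc M) (allFin _))

      best-min : ∀ j → b j ≤ suc M → o best ≤ o j
      best-min j bⱼ≤ = lookup (f[argmin]≤f[xs] F.zero _) (∈-filter⁺ (λ i → b i ≤? suc M) (∈-allFin j) bⱼ≤)

      best-rep : CoinCounts b (suc M) (suc (o best))
      best-rep = subst (λ N → CoinCounts b N (suc (o best))) (m∸n+n≡m best-fits) (addCoin (proj₁ (o-spec best)) best)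

      best-least : ∀ w → CoinCounts b (suc M) w → suc (o best) ≤ w
      best-least w r@(x , value≡ , _)
        with j , bⱼxⱼ>0 ← sumF-positive (λ j → b j * x j) (subst (0 <_) (sym value≡) (s≤s z≤n))
        with M′ , w′ , r′ , M≡ , refl ← removeCoin r j (>-nonZero⁻¹ _ {{m*n≢0⇒n≢0 (b j) {{>-nonZero bⱼxⱼ>0}}}})
        = s≤s (≤-trans (best-min j (subst (b j ≤_) (sym M≡) (m≤n+m (b j) M′)))
                       (proj₂ (o-spec j) w′ (subst (λ N → CoinCounts b N w′) M′≡ r′)))
        where
        M′≡ : M′ ≡ suc M ∸ b j
        M′≡ = trans (sym (m+n∸n≡m M′ (b j))) (cong (_∸ b j) (sym M≡))

  -- Opaque so that the type checker never unfolds the well-founded recursion behind O.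
  opaque
    ob-exists : ∀ M → Σ ℕ (IsOB b M)
    ob-exists = <-rec (λ M → Σ ℕ (IsOB b M)) optimal

  O : ℕ → ℕ
  O M = proj₁ (ob-exists M)

  O-spec : ∀ M → IsOB b M (O M)
  O-spec M = proj₂ (ob-exists M)

  O-rep : ∀ M → CoinCounts b M (O M)
  O-rep M = proj₁ (O-spec M)

  O-least : ∀ {M v} → CoinCounts b M v → O M ≤ v
  O-least {M} = proj₂ (O-spec M) _

  IsOB⇒≡O : ∀ {M v} → IsOB b M v → v ≡ O M
  IsOB⇒≡O (r , least) = ≤-antisym (least _ (O-rep _)) (O-least r)

  O-+coin : ∀ i M → O (M + b i) ≤ suc (O M)
  O-+coin i M = O-least (addCoin (O-rep M) i)

  O-+coins : ∀ i j M → O (M + j * b i) ≤ j + O M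
  O-+coins i zero    M = ≤-reflexive (cong O (+-identityʳ M))
  O-+coins i (suc j) M = begin
    O (M + (b i + j * b i))  ≡⟨ cong O (trans (cong (M +_) (+-comm (b i) (j * b i))) (sym (+-assoc M _ _))) ⟩
    O (M + j * b i + b i)    ≤⟨ O-+coin i (M + j * b i) ⟩
    suc (O (M + j * b i))    ≤⟨ s≤s (O-+coins i j M) ⟩
    suc (j + O M)            ∎
    where open ≤-Reasoning

argmin-unbounded : (f : ℕ → ℕ) → (∀ m → m ≤ f m) → ∃ λ m → ∀ m′ → f m ≤ f m′
argmin-unbounded f m≤f = best , minimal
  where
  best : ℕ
  best = argmin f 0 (upTo (suc (f 0)))
  minimal : ∀ m′ → f best ≤ f m′
  minimal m′ with m′ ≤? f 0
  ... | yes m′≤f0 = lookup (f[argmin]≤f[xs] {f = f} 0 (upTo (suc (f 0)))) (∈-upTo⁺ (s≤s m′≤f0))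
  ... | no  m′≰f0 = ≤-trans (f[argmin]≤f[⊤] {f = f} 0 (upTo (suc (f 0)))) (≤-trans (<⇒≤ (≰⇒> m′≰f0)) (m≤f m′))

shift-into-window : ∀ p .{{_ : NonZero p}} {a r} → r < a → ∃ λ j → a ∸ p ≤ r + j * p × r + j * p < a
shift-into-window p {a} {r} r<a = t / p , m≤n+o⇒m∸n≤o a p a≤ , r+jp<a
  where
  t : ℕ
  t = a ∸ suc r
  a≡ : a ≡ suc (r + t)
  a≡ = sym (m+[n∸m]≡n r<a)
  r+jp<a : r + t / p * p < a
  r+jp<a = subst (r + t / p * p <_) (sym a≡) (s≤s (+-monoʳ-≤ r (m/n*n≤m t p)))
  a≤ : a ≤ p + (r + t / p * p)
  a≤ = begin
    a                       ≡⟨ trans a≡ (sym (+-suc r t)) ⟩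
    r + suc t               ≡⟨ cong (λ t′ → r + suc t′) (m≡m%n+[m/n]*n t p) ⟩
    r + suc (t % p + t / p * p) ≤⟨ +-monoʳ-≤ r (+-monoˡ-≤ (t / p * p) (m%n<n t p)) ⟩
    r + (p + t / p * p)     ≡⟨ x∙yz≈y∙xz r p (t / p * p) ⟩
    p + (r + t / p * p)     ∎
    where open ≤-Reasoning

ceilDiv-spec : ∀ p q → 0 < q → p ≤ ceilDiv p q * q
ceilDiv-spec p (suc q) _ = +-cancelʳ-≤ q p (Q * suc q) (begin
  p + q                       ≡⟨ m≡m%n+[m/n]*n (p + q) (suc q) ⟩
  (p + q) % suc q + Q * suc q ≤⟨ +-monoˡ-≤ (Q * suc q) (s≤s⁻¹ (m%n<n (p + q) (suc q))) ⟩
  q + Q * suc q               ≡⟨ +-comm q (Q * suc q) ⟩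
  Q * suc q + q               ∎)
  where
  open ≤-Reasoning
  Q : ℕ
  Q = (p + q) / suc q

module CoinSystem (n : ℕ) (b : Fin (suc (suc n)) → ℕ) (b₀≡1 : b F.zero ≡ 1)
                  (b-strict : ∀ i j → i F.< j → b i < b j) where

  top : Fin (suc (suc n))
  top = fromℕ (suc n)

  bₖ bₖ₋₁ : ℕ
  bₖ   = b top
  bₖ₋₁ = b (inject₁ (fromℕ n))

  b-mono : ∀ i j → i F.≤ j → b i ≤ b j
  b-mono i j i≤j with m≤n⇒m<n∨m≡n i≤j
  ... | inj₁ i<j = <⇒≤ (b-strict i j i<j)
  ... | inj₂ i≡j = ≤-reflexive (cong b (toℕ-injective i≡j))

  b>0 : ∀ i → 0 < b i
  b>0 i = subst (_≤ b i) b₀≡1 (b-mono F.zero i z≤n)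

  b≤bₖ : ∀ j → b j ≤ bₖ
  b≤bₖ j = b-mono j top (≤fromℕ j)

  bₖ₋₁<bₖ : bₖ₋₁ < bₖ
  bₖ₋₁<bₖ = b-strict _ top (≤̄⇒inject₁< {i = fromℕ n} {j = fromℕ n} ≤-refl)

  b≤bₖ₋₁ : ∀ j → j ≢ top → b j ≤ bₖ₋₁
  b≤bₖ₋₁ j j≢top = b-mono j _ (subst (toℕ j ≤_) (sym toℕ[k-1]) (s≤s⁻¹ j<top))
    where
    toℕ[k-1] : toℕ (inject₁ (fromℕ n)) ≡ n
    toℕ[k-1] = trans (toℕ-inject₁ (fromℕ n)) (toℕ-fromℕ n)
    j<top : toℕ j < suc n
    j<top = ≤∧≢⇒< (toℕ≤pred[n] j) (λ eq → j≢top (toℕ-injective (trans eq (sym (toℕ-fromℕ (suc n))))))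

  instance
    bₖ≢0 : NonZero bₖ
    bₖ≢0 = >-nonZero (b>0 top)

  open Coins b
  open Optimal b b₀≡1 b>0 public

  value≤count*bₖ : ∀ {M v} → CoinCounts b M v → M ≤ v * bₖ
  value≤count*bₖ {v = v} r = ≤-trans (value≤*count bₖ r (λ j → *-monoˡ-≤ _ (b≤bₖ j))) (≤-reflexive (*-comm bₖ v))

  value≤bₖ₋₁*count : ∀ {M v} (r : CoinCounts b M v) → proj₁ r top ≡ 0 → M ≤ bₖ₋₁ * v
  value≤bₖ₋₁*count r@(x , _) x[top]≡0 = value≤*count bₖ₋₁ r bound
    where
    bound : ∀ j → b j * x j ≤ bₖ₋₁ * x j
    bound j with j F.≟ top
    ... | yes refl rewrite x[top]≡0 | *-zeroʳ bₖ | *-zeroʳ bₖ₋₁ = z≤n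
    ... | no j≢top = *-monoˡ-≤ (x j) (b≤bₖ₋₁ j j≢top)

  Candidate : (a h d r : ℕ) → ℕ → Set
  Candidate a h d r w = Σ ℕ λ m → Σ ℕ λ o → IsOB b (m * a + r) o × (w ≡ o * h * a + (m * a + r) * d)

  cost : (a h d r m : ℕ) → ℕ
  cost a h d r m = O (m * a + r) * h * a + (m * a + r) * d

  cost-candidate : ∀ a h d r m → Candidate a h d r (cost a h d r m)
  cost-candidate a h d r m = m , O (m * a + r) , O-spec (m * a + r) , refl

  least-cost : ∀ {a d} h → 0 < a → 0 < d → ∀ r → ∃ λ m → IsLeast (Candidate a h d r) (cost a h d r m)
  least-cost {a} {d} h a>0 d>0 r =
    m , cost-candidate a h d r m , lower-bound
    where
    instance
      _ : NonZero a
      _ = >-nonZero a>0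
      _ : NonZero d
      _ = >-nonZero d>0
    m≤cost : ∀ m → m ≤ cost a h d r m
    m≤cost m = begin
      m                  ≤⟨ m≤m*n m a ⟩
      m * a              ≤⟨ m≤m+n (m * a) r ⟩
      m * a + r          ≤⟨ m≤m*n (m * a + r) d ⟩
      (m * a + r) * d    ≤⟨ m≤n+m ((m * a + r) * d) _ ⟩
      cost a h d r m     ∎
      where open ≤-Reasoning
    m : ℕ
    m = proj₁ (argmin-unbounded (cost a h d r) m≤cost)
    lower-bound : ∀ w → Candidate a h d r w → cost a h d r m ≤ w
    lower-bound w (m′ , o , o-opt , refl) =
      subst (λ o → cost a h d r m ≤ o * h * a + (m′ * a + r) * d) (sym (IsOB⇒≡O o-opt))
            (proj₂ (argmin-unbounded (cost a h d r) m≤cost) m′)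

  module MaxResidue (c : ℕ) (c-max : IsGreatest (λ v → Σ ℕ λ r → (r < bₖ) × IsOB b r v) c) where

    O-residue≤c : ∀ r → r < bₖ → O r ≤ c
    O-residue≤c r r<bₖ = proj₂ c-max (O r) (r , r<bₖ , O-spec r)

    greedy-bound : ∀ N → O N ≤ N / bₖ + c
    greedy-bound N = begin
      O N                              ≡⟨ cong O (m≡m%n+[m/n]*n N bₖ) ⟩
      O (N % bₖ + (N / bₖ) * bₖ)       ≤⟨ O-+coins top (N / bₖ) (N % bₖ) ⟩
      N / bₖ + O (N % bₖ)              ≤⟨ +-monoʳ-≤ (N / bₖ) (O-residue≤c (N % bₖ) (m%n<n N bₖ)) ⟩
      N / bₖ + c                       ∎
      where open ≤-Reasoning

    module Threshold (u : ℕ) (u-large : (c ∸ 1) * bₖ₋₁ ≤ u * (bₖ ∸ bₖ₋₁)) where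

      count-without-top≥ : ∀ M v → (u ∸ 1) * bₖ ≤ M → M + bₖ ≤ bₖ₋₁ * v → M / bₖ + c ≤ v
      count-without-top≥ M v big M+bₖ≤ =
        ≤-trans (+-monoʳ-≤ Q (m≤n+m∸n c 1))
                (subst (_≤ v) (sym (+-suc Q (c ∸ 1))) (*-cancelˡ-< bₖ₋₁ _ _ (<-≤-trans chain M+bₖ≤)))
        where
        Q D : ℕ
        Q = M / bₖ
        D = bₖ ∸ bₖ₋₁
        u≤1+Q : u ≤ suc Q
        u≤1+Q = ≤-trans (m≤n+m∸n u 1) (s≤s (subst (_≤ Q) (m*n/n≡m (u ∸ 1) bₖ) (/-monoˡ-≤ bₖ big)))
        chain : bₖ₋₁ * (Q + (c ∸ 1)) < M + bₖ
        chain = begin-strict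
          bₖ₋₁ * (Q + (c ∸ 1))          ≡⟨ *-distribˡ-+ bₖ₋₁ Q (c ∸ 1) ⟩
          bₖ₋₁ * Q + bₖ₋₁ * (c ∸ 1)     ≤⟨ +-monoʳ-≤ (bₖ₋₁ * Q) (≤-trans (≤-reflexive (*-comm bₖ₋₁ (c ∸ 1))) u-large) ⟩
          bₖ₋₁ * Q + u * D              ≤⟨ +-monoʳ-≤ (bₖ₋₁ * Q) (*-monoˡ-≤ D u≤1+Q) ⟩
          bₖ₋₁ * Q + suc Q * D          <⟨ +-monoˡ-< (suc Q * D) (*-monoʳ-< bₖ₋₁ {{>-nonZero (b>0 _)}} (n<1+n Q)) ⟩
          bₖ₋₁ * suc Q + suc Q * D      ≡⟨ cong (_+ suc Q * D) (*-comm bₖ₋₁ (suc Q)) ⟩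
          suc Q * bₖ₋₁ + suc Q * D      ≡⟨ *-distribˡ-+ (suc Q) bₖ₋₁ D ⟨
          suc Q * (bₖ₋₁ + D)            ≡⟨ cong (suc Q *_) (m+[n∸m]≡n (<⇒≤ bₖ₋₁<bₖ)) ⟩
          bₖ + Q * bₖ                   ≡⟨ +-comm bₖ (Q * bₖ) ⟩
          Q * bₖ + bₖ                   ≤⟨ +-monoˡ-≤ bₖ (m/n*n≤m M bₖ) ⟩
          M + bₖ                        ∎
          where open ≤-Reasoning

      O-step-mono : ∀ M → (u ∸ 1) * bₖ ≤ M → O M ≤ O (M + bₖ)
      O-step-mono M big with proj₁ (O-rep (M + bₖ)) top in x[top]≡
      ... | zero = ≤-trans (greedy-bound M) (count-without-top≥ M _ big (value≤bₖ₋₁*count (O-rep (M + bₖ)) x[top]≡))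
      ... | suc _
        with M′ , v′ , r′ , M+bₖ≡ , O≡ ← removeCoin (O-rep (M + bₖ)) top (subst (0 <_) (sym x[top]≡) (s≤s z≤n))
        = begin
          O M           ≡⟨ cong O (+-cancelʳ-≡ bₖ M M′ M+bₖ≡) ⟩
          O M′          ≤⟨ O-least r′ ⟩
          v′            <⟨ n<1+n v′ ⟩
          suc v′        ≡⟨ O≡ ⟨
          O (M + bₖ)    ∎
        where open ≤-Reasoning

      O-steps-mono : ∀ j M → (u ∸ 1) * bₖ ≤ M → O M ≤ O (M + j * bₖ)
      O-steps-mono zero    M big = ≤-reflexive (cong O (sym (+-identityʳ M)))
      O-steps-mono (suc j) M big = begin
        O M                    ≤⟨ O-step-mono M big ⟩
        O (M + bₖ)             ≤⟨ O-steps-mono j (M + bₖ) (≤-trans big (m≤m+n M bₖ)) ⟩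
        O (M + bₖ + j * bₖ)    ≡⟨ cong O (+-assoc M bₖ (j * bₖ)) ⟩
        O (M + (bₖ + j * bₖ))  ∎
        where open ≤-Reasoning

      O-mono-above : ∀ j M → (u + c ∸ 1) * bₖ ≤ bₖ + (M + j * bₖ) → O M ≤ O (M + j * bₖ)
      O-mono-above j M thr with (u ∸ 1) * bₖ ≤? M
      ... | yes big = O-steps-mono j M big
      ... | no small = s≤s⁻¹ (begin
          suc (O M)                ≤⟨ s≤s (greedy-bound M) ⟩
          suc (M / bₖ + c)         ≤⟨ +-monoˡ-≤ c M/bₖ<u∸1 ⟩
          u ∸ 1 + c                ≡⟨ +-∸-comm c 1≤u ⟨
          u + c ∸ 1                ≤⟨ *-cancelʳ-≤ (u + c ∸ 1) (suc O′) bₖ (≤-trans thr (+-monoʳ-≤ bₖ (value≤count*bₖ (O-rep _)))) ⟩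
          suc O′                   ∎)
        where
        open ≤-Reasoning
        O′ : ℕ
        O′ = O (M + j * bₖ)
        M/bₖ<u∸1 : M / bₖ < u ∸ 1
        M/bₖ<u∸1 = m<n*o⇒m/o<n (≰⇒> small)
        1≤u : 1 ≤ u
        1≤u = ≤-trans (≤-<-trans z≤n M/bₖ<u∸1) (m∸n≤m u 1)

      cost-mono : ∀ {a} h d r j m → (u + c ∸ 1) * bₖ ≤ a → a ∸ bₖ ≤ r + j * bₖ →
                  cost a h d r m ≤ cost a h d (r + j * bₖ) m
      cost-mono {a} h d r j m a-large in-window =
        +-mono-≤ (*-monoˡ-≤ a (*-monoˡ-≤ h O-mono)) (*-monoˡ-≤ d (+-monoʳ-≤ (m * a) (m≤m+n r (j * bₖ))))
        where
        O-mono : O (m * a + r) ≤ O (m * a + (r + j * bₖ))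
        O-mono = subst (λ N → O (m * a + r) ≤ O N) (+-assoc (m * a) r (j * bₖ)) (O-mono-above j (m * a + r) (begin
          (u + c ∸ 1) * bₖ               ≤⟨ a-large ⟩
          a                              ≤⟨ m≤n+m∸n a bₖ ⟩
          bₖ + (a ∸ bₖ)                  ≤⟨ +-monoʳ-≤ bₖ (≤-trans in-window (m≤n+m (r + j * bₖ) (m * a))) ⟩
          bₖ + (m * a + (r + j * bₖ))    ≡⟨ cong (bₖ +_) (+-assoc (m * a) r (j * bₖ)) ⟨
          bₖ + (m * a + r + j * bₖ)      ∎))
          where open ≤-Reasoning

lemma3p2 : (n : ℕ) (b : Fin (suc (suc n)) → ℕ) →
    b F.zero ≡ 1 →
    (∀ i j → i F.< j → b i < b j) →
    (c : ℕ) →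
    IsGreatest (λ v → Σ ℕ λ r → (r < b (fromℕ (suc n))) × IsOB b r v) c →
    (a h d : ℕ) → 0 < a → 0 < h → 0 < d → gcd a d ≡ 1 →
    ((((c ∸ 1) ⊔ ceilDiv ((c ∸ 1) * b (inject₁ (fromℕ n))) (b (fromℕ (suc n)) ∸ b (inject₁ (fromℕ n)))) + c) ∸ 1) * b (fromℕ (suc n)) ≤ a →
    (M₁ M₂ : ℕ) →
    IsGreatest (λ v → Σ ℕ λ r → (r < a) ×
      IsLeast (λ w → Σ ℕ λ m → Σ ℕ λ o → IsOB b (m * a + r) o × (w ≡ o * h * a + (m * a + r) * d)) v) M₁ →
    IsGreatest (λ v → Σ ℕ λ r → (a ∸ b (fromℕ (suc n)) ≤ r) × (r < a) ×
      IsLeast (λ w → Σ ℕ λ m → Σ ℕ λ o → IsOB b (m * a + r) o × (w ≡ o * h * a + (m * a + r) * d)) v) M₂ →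
    M₁ ≡ M₂
lemma3p2 n b b₀≡1 b-strict c c-max a h d a>0 _ d>0 _ a-large M₁ M₂
         ((r , r<a , M₁-least) , M₁-max) ((r₂ , _ , r₂<a , M₂-least) , M₂-max) =
  ≤-antisym M₁≤M₂ (M₁-max M₂ (r₂ , r₂<a , M₂-least))
  where
  open CoinSystem n b b₀≡1 b-strict
  open MaxResidue c c-max
  u : ℕ
  u = (c ∸ 1) ⊔ ceilDiv ((c ∸ 1) * bₖ₋₁) (bₖ ∸ bₖ₋₁)
  open Threshold u (≤-trans (ceilDiv-spec _ _ (m<n⇒0<n∸m bₖ₋₁<bₖ)) (*-monoˡ-≤ (bₖ ∸ bₖ₋₁) (m≤n⊔m (c ∸ 1) _)))

  M₁≤M₂ : M₁ ≤ M₂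
  M₁≤M₂ = begin
    M₁                ≤⟨ proj₂ M₁-least _ (cost-candidate a h d r m) ⟩
    cost a h d r m    ≤⟨ cost-mono h d r j m a-large in-window ⟩
    cost a h d r′ m   ≤⟨ M₂-max _ (r′ , in-window , r′<a , m-least) ⟩
    M₂                ∎
    where
    open ≤-Reasoning
    shifted : ∃ λ j → a ∸ bₖ ≤ r + j * bₖ × r + j * bₖ < a
    shifted = shift-into-window bₖ r<a
    j r′ m : ℕ
    j = proj₁ shifted
    r′ = r + j * bₖ
    m = proj₁ (least-cost h a>0 d>0 r′)
    in-window : a ∸ bₖ ≤ r′
    in-window = proj₁ (proj₂ shifted)
    r′<a : r′ < a
    r′<a = proj₂ (proj₂ shifted)
    m-least : IsLeast (Candidate a h d r′) (cost a h d r′ m)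
    m-least = proj₂ (least-cost h a>0 d>0 r′)
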